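{- For $n\geq 0$ let $a_n$ be the number of weakly even-up Catalan words of length $n$ and $b_n$ the number of weakly odd-up Catalan words of length $n$, and let $A(x)=\sum_{n\geq 0}a_nx^n$, $B(x)=\sum_{n\geq 0}b_nx^n$. Then \[A(x)=\frac{1-x-\sqrt{(1+x^2)^2-4x}}{x},\qquad B(x)=-\frac{x^3+2x^2+x-2+(x+2)\sqrt{(1+x^2)^2-4x}}{2x}.\]
   Context: A Catalan word of length $n$ is a word $w_1\cdots w_n\in\{1,\ldots,n\}^n$ with $w_1=1$ and $w_{i+1}\leq w_i+1$ for every $i\in\{1,\ldots,n-1\}$; for $n=0$ the empty word is the unique Catalan word. A word $w_1\cdots w_n$ is weakly even-up if for every $i\in\{1,\ldots,n-1\}$, whenever $w_i$ is even, $w_{i+1}\geq w_i$; it is weakly odd-up if for every $i\in\{1,\ldots,n-1\}$, whenever $w_i$ is odd, $w_{i+1}\geq w_i$. The square roots denote the power series branch with constant term $1$. -}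

module Defs where

open import Data.Nat as ℕ using (ℕ; zero; suc; _∸_)
open import Data.Bool using (Bool; true; false; _∧_; if_then_else_; not)
open import Data.List using (List; []; _∷_; concatMap; map; length)
open import Data.Integer as ℤ using (ℤ; +_; _+_; _*_; -_)

letters : ℕ → List ℕ
letters zero    = []
letters (suc n) = letters n Data.List.++ (suc n ∷ [])

words : ℕ → ℕ → List (List ℕ)
words n zero    = [] ∷ []
words n (suc m) = concatMap (λ a → map (a ∷_) (words n m)) (letters n)

stepsOK : List ℕ → Bool
stepsOK (a ∷ b ∷ w) = (b ℕ.≤ᵇ suc a) ∧ stepsOK (b ∷ w)
stepsOK _           = true

-- Catalan word (letters already assumed in {1..n}): w_1 = 1 and steps OK;
-- the empty word is Catalan.
isCatalan : List ℕ → Bool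
isCatalan []      = true
isCatalan (a ∷ w) = (a ℕ.≡ᵇ 1) ∧ stepsOK (a ∷ w)

isEven : ℕ → Bool
isEven zero          = true
isEven (suc zero)    = false
isEven (suc (suc n)) = isEven n

weaklyEvenUp : List ℕ → Bool
weaklyEvenUp (a ∷ b ∷ w) =
  (if isEven a then a ℕ.≤ᵇ b else true) ∧ weaklyEvenUp (b ∷ w)
weaklyEvenUp _ = true

weaklyOddUp : List ℕ → Bool
weaklyOddUp (a ∷ b ∷ w) =
  (if not (isEven a) then a ℕ.≤ᵇ b else true) ∧ weaklyOddUp (b ∷ w)
weaklyOddUp _ = true

count : {A : Set} → (A → Bool) → List A → ℕ
count p []      = zero
count p (x ∷ l) = if p x then suc (count p l) else count p l

aSeq : ℕ → ℕ
aSeq n = count (λ w → isCatalan w ∧ weaklyEvenUp w) (words n n)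

bSeq : ℕ → ℕ
bSeq n = count (λ w → isCatalan w ∧ weaklyOddUp w) (words n n)

PS : Set
PS = ℕ → ℤ

_≋_ : PS → PS → Set
f ≋ g = ∀ k → f k Relation.Binary.PropositionalEquality.≡ g k
  where import Relation.Binary.PropositionalEquality

infix 4 _≋_

sumTo : ℕ → (ℕ → ℤ) → ℤ
sumTo zero    h = h zero
sumTo (suc k) h = sumTo k h + h (suc k)

_⊕_ : PS → PS → PS
(f ⊕ g) k = f k + g k

⊝_ : PS → PS
(⊝ f) k = - f k

_⊛_ : PS → PS → PS
(f ⊛ g) k = sumTo k (λ i → f i * g (k ∸ i))

infixl 6 _⊕_
infixl 7 _⊛_

poly : List ℤ → PS
poly []      k       = + 0
poly (c ∷ _) zero    = c
poly (_ ∷ l) (suc k) = poly l k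

A : PS
A n = + aSeq n

B : PS
B n = + bSeq n

-- (1+x²)² − 4x = 1 − 4x + 2x² + x⁴
D : PS
D = poly (+ 1 ∷ - (+ 4) ∷ + 2 ∷ + 0 ∷ + 1 ∷ [])

{-# OPTIONS --safe #-}
-- Reading a Catalan word letter by letter is a walk on the states d = letter − 1,
-- stepping from d to some e ≤ d + 1, where e ≥ d is required if the letter d + 1 is
-- constrained (even for even-up, odd for odd-up words).  Cutting a walk at its
-- first visit to the root state gives recurrences which are solved by
-- A = 1 + x (1 + 2E) and B = A + x² E, where E counts the odd-up walks ending on an
-- even letter and satisfies E = x + x (2 + x) E + x² E².  Hence S = 1 − x − x A
-- = 1 − 2x − x² − 2x² E squares to 1 − 4x + 2x² + x⁴; all identities are checked
-- coefficientwise.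
module Submission where

open import Algebra.Bundles using (CommutativeMonoid)
open import Data.Bool using (Bool; true; false; not; _∧_; if_then_else_)
import Data.Bool.Properties as Boolₚ
open import Data.Integer using (ℤ; +_; -_; _+_; _*_)
import Data.Integer.Properties as ℤₚ
open import Data.Integer.Tactic.RingSolver using (solve-∀)
open import Data.List using (List; []; _∷_; _++_; map; concat; concatMap)
open import Data.List.Properties using (map-++; concat-++; ++-identityʳ)
open import Data.Nat as ℕ using (ℕ; zero; suc; _≤_; _<_; _∸_; _≤ᵇ_; z≤n; s≤s)
open import Data.Nat.Induction using (<-rec)
import Data.Nat.Properties as ℕₚ
open import Data.Product using (Σ; _×_; _,_; proj₁; proj₂)
open import Data.Sum using (inj₁; inj₂)
open import Function using (_∘_)
open import Function.Bundles using (Equivalence)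
open import Relation.Binary.PropositionalEquality
  using (_≡_; refl; sym; trans; cong; cong₂; module ≡-Reasoning)
open ≡-Reasoning

open import Algebra.Properties.CommutativeSemigroup ℤₚ.+-commutativeSemigroup
  using (interchange; x∙yz≈y∙xz)
import Algebra.Properties.CommutativeSemigroup
  (CommutativeMonoid.commutativeSemigroup Boolₚ.∧-commutativeMonoid) as ∧

open import Defs

sumTo-cong : ∀ n {g h : ℕ → ℤ} → (∀ i → i ≤ n → g i ≡ h i) → sumTo n g ≡ sumTo n h
sumTo-cong zero    g≗h = g≗h 0 z≤n
sumTo-cong (suc n) g≗h =
  cong₂ _+_ (sumTo-cong n (λ i i≤n → g≗h i (ℕₚ.m≤n⇒m≤1+n i≤n)))
            (g≗h (suc n) ℕₚ.≤-refl)

sumTo-zero : ∀ n {h : ℕ → ℤ} → (∀ i → h i ≡ + 0) → sumTo n h ≡ + 0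
sumTo-zero zero    h≗0 = h≗0 0
sumTo-zero (suc n) h≗0 = cong₂ _+_ (sumTo-zero n h≗0) (h≗0 (suc n))

sumTo-peel : ∀ n (h : ℕ → ℤ) → sumTo (suc n) h ≡ h 0 + sumTo n (h ∘ suc)
sumTo-peel zero    h = refl
sumTo-peel (suc n) h =
  trans (cong (_+ h (suc (suc n))) (sumTo-peel n h)) (ℤₚ.+-assoc (h 0) _ _)

sumTo-reverse : ∀ n (h : ℕ → ℤ) → sumTo n h ≡ sumTo n (λ i → h (n ∸ i))
sumTo-reverse zero    h = refl
sumTo-reverse (suc n) h = begin
  sumTo (suc n) h                          ≡⟨ sumTo-peel n h ⟩
  h 0 + sumTo n (h ∘ suc)                  ≡⟨ cong (λ s → h 0 + s) (sumTo-reverse n (h ∘ suc)) ⟩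
  h 0 + sumTo n (λ i → h (suc (n ∸ i)))    ≡⟨ ℤₚ.+-comm (h 0) _ ⟩
  sumTo n (λ i → h (suc (n ∸ i))) + h 0
    ≡⟨ cong₂ _+_ (sumTo-cong n (λ i i≤n → cong h (sym (ℕₚ.+-∸-assoc 1 i≤n))))
                 (cong h (sym (ℕₚ.n∸n≡0 n))) ⟩
  sumTo (suc n) (λ i → h (suc n ∸ i))      ∎

sumTo-truncate : ∀ {k} K (h : ℕ → ℤ) → k ≤ K → (∀ i → k < i → h i ≡ + 0) →
                 sumTo K h ≡ sumTo k h
sumTo-truncate zero    h z≤n   _      = refl
sumTo-truncate (suc K) h k≤1+K vanish with ℕₚ.m≤n⇒m<n∨m≡n k≤1+K
... | inj₁ (s≤s k≤K) =
  trans (cong₂ _+_ (sumTo-truncate K h k≤K vanish) (vanish (suc K) (s≤s k≤K))) (ℤₚ.+-identityʳ _)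
... | inj₂ refl = refl

sumTo-+ : ∀ n (g h : ℕ → ℤ) → sumTo n (λ i → g i + h i) ≡ sumTo n g + sumTo n h
sumTo-+ zero    g h = refl
sumTo-+ (suc n) g h = trans (cong (_+ (g (suc n) + h (suc n))) (sumTo-+ n g h))
                            (interchange (sumTo n g) (sumTo n h) (g (suc n)) (h (suc n)))

sumTo-*ˡ : ∀ n c (h : ℕ → ℤ) → sumTo n (λ i → c * h i) ≡ c * sumTo n h
sumTo-*ˡ zero    c h = refl
sumTo-*ˡ (suc n) c h = trans (cong (_+ c * h (suc n)) (sumTo-*ˡ n c h))
                             (sym (ℤₚ.*-distribˡ-+ c (sumTo n h) (h (suc n))))

sumTo-*ʳ : ∀ n c (h : ℕ → ℤ) → sumTo n (λ i → h i * c) ≡ sumTo n h * c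
sumTo-*ʳ n c h = begin
  sumTo n (λ i → h i * c) ≡⟨ sumTo-cong n (λ i _ → ℤₚ.*-comm (h i) c) ⟩
  sumTo n (λ i → c * h i) ≡⟨ sumTo-*ˡ n c h ⟩
  c * sumTo n h           ≡⟨ ℤₚ.*-comm c _ ⟩
  sumTo n h * c           ∎

sumTo-neg : ∀ n (h : ℕ → ℤ) → sumTo n (λ i → - h i) ≡ - sumTo n h
sumTo-neg zero    h = refl
sumTo-neg (suc n) h = trans (cong (_+ - h (suc n)) (sumTo-neg n h))
                            (sym (ℤₚ.neg-distrib-+ (sumTo n h) (h (suc n))))

sumTo-swap : ∀ k n (h : ℕ → ℕ → ℤ) →
             sumTo k (λ e → sumTo n (h e)) ≡ sumTo n (λ i → sumTo k (λ e → h e i))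
sumTo-swap zero    n h = refl
sumTo-swap (suc k) n h = trans (cong (_+ sumTo n (h (suc k))) (sumTo-swap k n h))
                               (sym (sumTo-+ n _ (h (suc k))))

⊛-suc : ∀ f g n → (f ⊛ g) (suc n) ≡ f 0 * g (suc n) + ((f ∘ suc) ⊛ g) n
⊛-suc f g n = sumTo-peel n _

⊛-comm : ∀ f g n → (f ⊛ g) n ≡ (g ⊛ f) n
⊛-comm f g n = trans (sumTo-reverse n _) (sumTo-cong n λ i i≤n →
  trans (cong (λ j → f (n ∸ i) * g j) (ℕₚ.m∸[m∸n]≡n i≤n)) (ℤₚ.*-comm (f (n ∸ i)) (g i)))

⊛-congˡ : ∀ {f f′} g → f ≋ f′ → ∀ n → (f ⊛ g) n ≡ (f′ ⊛ g) n
⊛-congˡ g f≋f′ n = sumTo-cong n (λ i _ → cong (_* g (n ∸ i)) (f≋f′ i))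

⊛-congʳ-upTo : ∀ f {g g′} n → (∀ j → j ≤ n → g j ≡ g′ j) → (f ⊛ g) n ≡ (f ⊛ g′) n
⊛-congʳ-upTo f n g≗g′ = sumTo-cong n (λ i _ → cong (f i *_) (g≗g′ (n ∸ i) (ℕₚ.m∸n≤m n i)))

⊛-distribʳ-⊕ : ∀ f f′ g n → ((f ⊕ f′) ⊛ g) n ≡ (f ⊛ g) n + (f′ ⊛ g) n
⊛-distribʳ-⊕ f f′ g n =
  trans (sumTo-cong n (λ i _ → ℤₚ.*-distribʳ-+ (g (n ∸ i)) (f i) (f′ i))) (sumTo-+ n _ _)

⊛-negˡ : ∀ f g n → ((⊝ f) ⊛ g) n ≡ - (f ⊛ g) n
⊛-negˡ f g n =
  trans (sumTo-cong n (λ i _ → sym (ℤₚ.neg-distribˡ-* (f i) (g (n ∸ i))))) (sumTo-neg n _)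

⊛-scaleˡ : ∀ c f g n → ((λ i → c * f i) ⊛ g) n ≡ c * (f ⊛ g) n
⊛-scaleˡ c f g n = trans (sumTo-cong n (λ i _ → ℤₚ.*-assoc c (f i) (g (n ∸ i)))) (sumTo-*ˡ n c _)

sumTo-⊛ : ∀ k (u : ℕ → PS) g n →
          sumTo k (λ e → (u e ⊛ g) n) ≡ ((λ i → sumTo k (λ e → u e i)) ⊛ g) n
sumTo-⊛ k u g n = trans (sumTo-swap k n _) (sumTo-cong n (λ i _ → sumTo-*ʳ k (g (n ∸ i)) (λ e → u e i)))

δ : PS
δ = poly (+ 1 ∷ [])

const-⊛ : ∀ c g n → (poly (c ∷ []) ⊛ g) n ≡ c * g n
const-⊛ c g zero    = refl
const-⊛ c g (suc n) = begin
  (poly (c ∷ []) ⊛ g) (suc n)          ≡⟨ ⊛-suc (poly (c ∷ [])) g n ⟩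
  c * g (suc n) + (poly [] ⊛ g) n      ≡⟨ cong (λ s → c * g (suc n) + s) (sumTo-zero n (λ _ → refl)) ⟩
  c * g (suc n) + + 0                  ≡⟨ ℤₚ.+-identityʳ _ ⟩
  c * g (suc n)                        ∎

δ-⊛ : ∀ g n → (δ ⊛ g) n ≡ g n
δ-⊛ g n = trans (const-⊛ (+ 1) g n) (ℤₚ.*-identityˡ (g n))

linear-⊛ : ∀ c₀ c₁ g n → (poly (c₀ ∷ c₁ ∷ []) ⊛ g) (suc n) ≡ c₀ * g (suc n) + c₁ * g n
linear-⊛ c₀ c₁ g n = trans (⊛-suc (poly (c₀ ∷ c₁ ∷ [])) g n)
                           (cong (λ s → c₀ * g (suc n) + s) (const-⊛ c₁ g n))

shift : PS → PS
shift f zero    = + 0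
shift f (suc k) = f k

shift-⊛ : ∀ f g n → (shift f ⊛ g) n ≡ shift (f ⊛ g) n
shift-⊛ f g zero    = refl
shift-⊛ f g (suc n) = trans (⊛-suc (shift f) g n) (ℤₚ.+-identityˡ _)

⟦_⟧ : Bool → ℤ
⟦ true  ⟧ = + 1
⟦ false ⟧ = + 0

-- State d stands for the letter d + 1; r d = true means that this letter may only
-- be followed by letters at least as large.
canStep : (ℕ → Bool) → ℕ → ℕ → Bool
canStep r d e = if r d then d ≤ᵇ e else true

walks : (ℕ → Bool) → (ℕ → ℤ) → ℕ → ℕ → ℤ
walks r f zero    d = f d
walks r f (suc m) d = sumTo (suc d) (λ e → ⟦ canStep r d e ⟧ * walks r f m e)

allWalks freeWalks : (ℕ → Bool) → ℕ → ℕ → ℤ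
allWalks  r = walks r (λ _ → + 1)
freeWalks r = walks r (λ d → ⟦ not (r d) ⟧)

suc-≤ᵇ-suc : ∀ m n → (suc m ≤ᵇ suc n) ≡ (m ≤ᵇ n)
suc-≤ᵇ-suc zero    n = refl
suc-≤ᵇ-suc (suc m) n = refl

≤⇒≤ᵇ≡true : ∀ {m n} → m ≤ n → (m ≤ᵇ n) ≡ true
≤⇒≤ᵇ≡true m≤n = Equivalence.to Boolₚ.T-≡ (ℕₚ.≤⇒≤ᵇ m≤n)

>⇒≤ᵇ≡false : ∀ {m n} → n < m → (m ≤ᵇ n) ≡ false
>⇒≤ᵇ≡false {m} {n} n<m =
  Boolₚ.¬-not (λ m≤ᵇn → ℕₚ.<⇒≱ n<m (ℕₚ.≤ᵇ⇒≤ m n (Equivalence.from Boolₚ.T-≡ m≤ᵇn)))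

canStep-from-0 : ∀ r e → canStep r 0 e ≡ true
canStep-from-0 r e with r 0
... | true  = refl
... | false = refl

canStep-to-0 : ∀ r d → canStep r (suc d) 0 ≡ not (r (suc d))
canStep-to-0 r d with r (suc d)
... | true  = refl
... | false = refl

canStep-suc : ∀ r d e → canStep r (suc d) (suc e) ≡ canStep (r ∘ suc) d e
canStep-suc r d e = cong (if r (suc d) then_else true) (suc-≤ᵇ-suc d e)

walks-from-0 : ∀ r f m → walks r f (suc m) 0 ≡ walks r f m 0 + walks r f m 1
walks-from-0 r f m = cong₂ _+_ (unconstrained 0) (unconstrained 1)
  where
  unconstrained : ∀ e → ⟦ canStep r 0 e ⟧ * walks r f m e ≡ walks r f m e
  unconstrained e = trans (cong (λ b → ⟦ b ⟧ * walks r f m e) (canStep-from-0 r e)) (ℤₚ.*-identityˡ _)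

walks-suc-split : ∀ r f m d → walks r f (suc m) (suc d) ≡
  ⟦ not (r (suc d)) ⟧ * walks r f m 0
  + sumTo (suc d) (λ e → ⟦ canStep (r ∘ suc) d e ⟧ * walks r f m (suc e))
walks-suc-split r f m d = trans (sumTo-peel (suc d) _) (cong₂ _+_
  (cong (λ b → ⟦ b ⟧ * walks r f m 0) (canStep-to-0 r d))
  (sumTo-cong (suc d) (λ e _ → cong (λ b → ⟦ b ⟧ * walks r f m (suc e)) (canStep-suc r d e))))

-- A walk from a positive state either stays positive (a walk of the shifted
-- system) or first reaches state 0 from a state whose letter may be followed by 1.
walks-firstPassage : ∀ r f m d → walks r f (suc m) (suc d) ≡
  walks (r ∘ suc) (f ∘ suc) (suc m) d
  + ((λ k → freeWalks (r ∘ suc) k d) ⊛ (λ j → walks r f j 0)) m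
walks-firstPassage r f zero d =
  trans (walks-suc-split r f 0 d) (ℤₚ.+-comm _ (walks (r ∘ suc) (f ∘ suc) 1 d))
walks-firstPassage r f (suc m) d = begin
  walks r f (suc (suc m)) (suc d)
    ≡⟨ walks-suc-split r f (suc m) d ⟩
  first + sumTo (suc d) (λ e → a e * walks r f (suc m) (suc e))
    ≡⟨ cong (λ s → first + s) (sumTo-cong (suc d) (λ e _ → cong (a e *_) (walks-firstPassage r f m e))) ⟩
  first + sumTo (suc d) (λ e → a e * (walks′ (suc m) e + (F e ⊛ v) m))
    ≡⟨ cong (λ s → first + s) (trans (sumTo-cong (suc d) (λ e _ → ℤₚ.*-distribˡ-+ (a e) _ _))
                                     (sumTo-+ (suc d) _ _)) ⟩
  first + (walks′ (suc (suc m)) d + sumTo (suc d) (λ e → a e * (F e ⊛ v) m))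
    ≡⟨ cong (λ s → first + (walks′ (suc (suc m)) d + s)) (trans
         (sumTo-cong (suc d) (λ e _ → sym (⊛-scaleˡ (a e) (F e) v m)))
         (sumTo-⊛ (suc d) (λ e k → a e * F e k) v m)) ⟩
  first + (walks′ (suc (suc m)) d + ((λ k → freeWalks (r ∘ suc) (suc k) d) ⊛ v) m)
    ≡⟨ x∙yz≈y∙xz first (walks′ (suc (suc m)) d) _ ⟩
  walks′ (suc (suc m)) d + (first + ((λ k → freeWalks (r ∘ suc) (suc k) d) ⊛ v) m)
    ≡⟨ cong (λ s → walks′ (suc (suc m)) d + s) (sym (⊛-suc (λ k → freeWalks (r ∘ suc) k d) v m)) ⟩
  walks′ (suc (suc m)) d + ((λ k → freeWalks (r ∘ suc) k d) ⊛ v) (suc m) ∎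
  where
  walks′ = walks (r ∘ suc) (f ∘ suc)
  v = λ j → walks r f j 0
  a = λ e → ⟦ canStep (r ∘ suc) d e ⟧
  F = λ e k → freeWalks (r ∘ suc) k e
  first = ⟦ not (r (suc d)) ⟧ * walks r f (suc m) 0

walks-root : ∀ r f m → walks r f (suc (suc m)) 0 ≡
  walks r f (suc m) 0 + walks (r ∘ suc) (f ∘ suc) (suc m) 0
  + ((λ k → freeWalks (r ∘ suc) k 0) ⊛ (λ j → walks r f j 0)) m
walks-root r f m =
  trans (walks-from-0 r f (suc m))
        (trans (cong (λ s → walks r f (suc m) 0 + s) (walks-firstPassage r f m 0))
               (sym (ℤₚ.+-assoc (walks r f (suc m) 0) _ _)))

weaklyUp : (ℕ → Bool) → List ℕ → Bool
weaklyUp ρ (a ∷ b ∷ w) = (if ρ a then a ≤ᵇ b else true) ∧ weaklyUp ρ (b ∷ w)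
weaklyUp ρ _           = true

weaklyEvenUp≡weaklyUp : ∀ w → weaklyEvenUp w ≡ weaklyUp isEven w
weaklyEvenUp≡weaklyUp []          = refl
weaklyEvenUp≡weaklyUp (a ∷ [])    = refl
weaklyEvenUp≡weaklyUp (a ∷ b ∷ w) = cong (_ ∧_) (weaklyEvenUp≡weaklyUp (b ∷ w))

weaklyOddUp≡weaklyUp : ∀ w → weaklyOddUp w ≡ weaklyUp (not ∘ isEven) w
weaklyOddUp≡weaklyUp []          = refl
weaklyOddUp≡weaklyUp (a ∷ [])    = refl
weaklyOddUp≡weaklyUp (a ∷ b ∷ w) = cong (_ ∧_) (weaklyOddUp≡weaklyUp (b ∷ w))

not-isEven-suc : ∀ n → not (isEven (suc n)) ≡ isEven n
not-isEven-suc zero          = refl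
not-isEven-suc (suc zero)    = refl
not-isEven-suc (suc (suc n)) = not-isEven-suc n

module _ {X : Set} where

  count-cong : ∀ {p q : X → Bool} xs → (∀ x → p x ≡ q x) → count p xs ≡ count q xs
  count-cong []       p≗q = refl
  count-cong (x ∷ xs) p≗q rewrite p≗q x = cong (λ n → if _ then suc n else n) (count-cong xs p≗q)

  count-++ : ∀ (p : X → Bool) xs ys → count p (xs ++ ys) ≡ count p xs ℕ.+ count p ys
  count-++ p []       ys = refl
  count-++ p (x ∷ xs) ys with p x
  ... | true  = cong suc (count-++ p xs ys)
  ... | false = count-++ p xs ys

  count-false : ∀ xs → count {X} (λ _ → false) xs ≡ 0
  count-false []       = refl
  count-false (x ∷ xs) = count-false xs

  count-map : ∀ {Y : Set} (p : X → Bool) (g : Y → X) ys → count p (map g ys) ≡ count (p ∘ g) ys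
  count-map p g []       = refl
  count-map p g (y ∷ ys) with p (g y)
  ... | true  = cong suc (count-map p g ys)
  ... | false = count-map p g ys

  count-concatMap-++ : ∀ {Y : Set} (p : X → Bool) (f : Y → List X) ys zs →
    count p (concatMap f (ys ++ zs)) ≡ count p (concatMap f ys) ℕ.+ count p (concatMap f zs)
  count-concatMap-++ p f ys zs = begin
    count p (concat (map f (ys ++ zs)))            ≡⟨ cong (count p ∘ concat) (map-++ f ys zs) ⟩
    count p (concat (map f ys ++ map f zs))        ≡⟨ cong (count p) (sym (concat-++ (map f ys) (map f zs))) ⟩
    count p (concatMap f ys ++ concatMap f zs)     ≡⟨ count-++ p (concatMap f ys) _ ⟩
    count p (concatMap f ys) ℕ.+ count p (concatMap f zs) ∎

  count-∧ˡ : ∀ b (p : X → Bool) xs → + count (λ x → b ∧ p x) xs ≡ ⟦ b ⟧ * + count p xs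
  count-∧ˡ true  p xs = sym (ℤₚ.*-identityˡ _)
  count-∧ˡ false p []       = refl
  count-∧ˡ false p (x ∷ xs) = count-∧ˡ false p xs

count-words-suc : ∀ (p : List ℕ → Bool) k ws →
  + count p (concatMap (λ a → map (a ∷_) ws) (letters (suc k)))
  ≡ sumTo k (λ i → + count (p ∘ (suc i ∷_)) ws)
count-words-suc p k ws = go k
  where
  prefixed : ℕ → List (List ℕ)
  prefixed a = map (a ∷_) ws
  single : ∀ a → count p (concatMap prefixed (a ∷ [])) ≡ count (p ∘ (a ∷_)) ws
  single a = trans (cong (count p) (++-identityʳ (prefixed a))) (count-map p (a ∷_) ws)
  go : ∀ k → + count p (concatMap prefixed (letters (suc k))) ≡ sumTo k (λ i → + count (p ∘ (suc i ∷_)) ws)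
  go zero    = cong +_ (single 1)
  go (suc k) = begin
    + count p (concatMap prefixed (letters (suc k) ++ suc (suc k) ∷ []))
      ≡⟨ cong +_ (count-concatMap-++ p prefixed (letters (suc k)) _) ⟩
    + (count p (concatMap prefixed (letters (suc k))) ℕ.+ count p (concatMap prefixed (suc (suc k) ∷ [])))
      ≡⟨ ℤₚ.pos-+ (count p (concatMap prefixed (letters (suc k)))) _ ⟩
    + count p (concatMap prefixed (letters (suc k))) + + count p (concatMap prefixed (suc (suc k) ∷ []))
      ≡⟨ cong₂ _+_ (go k) (cong +_ (single (suc (suc k)))) ⟩
    sumTo (suc k) (λ i → + count (p ∘ (suc i ∷_)) ws) ∎

continues : (ℕ → Bool) → ℕ → List ℕ → Bool
continues ρ a w = stepsOK (a ∷ w) ∧ weaklyUp ρ (a ∷ w)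

count-continues : ∀ ρ r → (∀ d → ρ (suc d) ≡ r d) →
  ∀ m N d → suc d ℕ.+ m ≤ N → + count (continues ρ (suc d)) (words N m) ≡ allWalks r m d
count-continues ρ r ρ∘suc≗r zero    N       d _ = refl
count-continues ρ r ρ∘suc≗r (suc m) (suc K) d (s≤s d+[1+m]≤K) = begin
  + count (continues ρ (suc d)) (words (suc K) (suc m))
    ≡⟨ count-words-suc (continues ρ (suc d)) K ws ⟩
  sumTo K (λ i → + count (continues ρ (suc d) ∘ (suc i ∷_)) ws)
    ≡⟨ sumTo-cong K (λ i _ → trans (cong +_ (count-cong ws (continues-∷ i))) (count-∧ˡ (fits i) _ ws)) ⟩
  sumTo K (λ i → ⟦ fits i ⟧ * + count (continues ρ (suc i)) ws)
    ≡⟨ sumTo-truncate K _ d+1≤K (λ i d+1<i →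
         cong (λ b → ⟦ b ⟧ * + count (continues ρ (suc i)) ws) (fits-beyond i d+1<i)) ⟩
  sumTo (suc d) (λ i → ⟦ fits i ⟧ * + count (continues ρ (suc i)) ws)
    ≡⟨ sumTo-cong (suc d) (λ i i≤d+1 → cong₂ (λ b n → ⟦ b ⟧ * n) (fits-within i i≤d+1)
                                           (count-continues ρ r ρ∘suc≗r m (suc K) i (within i≤d+1))) ⟩
  allWalks r (suc m) d ∎
  where
  ws = words (suc K) m
  fits : ℕ → Bool
  fits i = (suc i ≤ᵇ suc (suc d)) ∧ (if ρ (suc d) then suc d ≤ᵇ suc i else true)
  continues-∷ : ∀ i w → continues ρ (suc d) (suc i ∷ w) ≡ fits i ∧ continues ρ (suc i) w
  continues-∷ i w = ∧.interchange (suc i ≤ᵇ suc (suc d)) (stepsOK (suc i ∷ w)) _ (weaklyUp ρ (suc i ∷ w))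
  fits-beyond : ∀ i → suc d < i → fits i ≡ false
  fits-beyond i d+1<i = cong (_∧ (if ρ (suc d) then suc d ≤ᵇ suc i else true)) (>⇒≤ᵇ≡false (s≤s d+1<i))
  fits-within : ∀ i → i ≤ suc d → fits i ≡ canStep r d i
  fits-within i i≤d+1 = begin
    (suc i ≤ᵇ suc (suc d)) ∧ (if ρ (suc d) then suc d ≤ᵇ suc i else true)
      ≡⟨ cong₂ (λ b c → b ∧ (if c then suc d ≤ᵇ suc i else true))
               (≤⇒≤ᵇ≡true (s≤s i≤d+1)) (ρ∘suc≗r d) ⟩
    (if r d then suc d ≤ᵇ suc i else true)
      ≡⟨ cong (if r d then_else true) (suc-≤ᵇ-suc d i) ⟩
    canStep r d i ∎
  bound : suc d ℕ.+ m ≤ K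
  bound = ℕₚ.≤-trans (ℕₚ.≤-reflexive (sym (ℕₚ.+-suc d m))) d+[1+m]≤K
  d+1≤K : suc d ≤ K
  d+1≤K = ℕₚ.≤-trans (ℕₚ.m≤m+n (suc d) m) bound
  within : ∀ {i} → i ≤ suc d → suc i ℕ.+ m ≤ suc K
  within i≤d+1 = s≤s (ℕₚ.≤-trans (ℕₚ.+-monoˡ-≤ m i≤d+1) bound)

count-catalan : ∀ ρ r → (∀ d → ρ (suc d) ≡ r d) → ∀ n →
  + count (λ w → isCatalan w ∧ weaklyUp ρ w) (words (suc n) (suc n)) ≡ allWalks r n 0
count-catalan ρ r ρ∘suc≗r n = begin
  + count catalan (words (suc n) (suc n))
    ≡⟨ count-words-suc catalan n ws ⟩
  sumTo n (λ i → + count (catalan ∘ (suc i ∷_)) ws)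
    ≡⟨ sumTo-truncate n _ z≤n (λ { (suc i) _ → cong +_ (count-false ws) }) ⟩
  + count (continues ρ 1) ws
    ≡⟨ count-continues ρ r ρ∘suc≗r n (suc n) 0 ℕₚ.≤-refl ⟩
  allWalks r n 0 ∎
  where
  catalan = λ w → isCatalan w ∧ weaklyUp ρ w
  ws = words (suc n) n

-- Even-up words constrain the states d with d + 1 even, odd-up words those with d even.
Wₑ Wₒ E E′ : PS
Wₑ n = allWalks  (isEven ∘ suc) n 0
Wₒ n = allWalks  isEven         n 0
E  n = freeWalks isEven         n 0
E′ n = freeWalks (isEven ∘ suc) n 0

A-suc : ∀ n → A (suc n) ≡ Wₑ n
A-suc n = trans
  (cong +_ (count-cong (words (suc n) (suc n)) (λ w → cong (isCatalan w ∧_) (weaklyEvenUp≡weaklyUp w))))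
  (count-catalan isEven (isEven ∘ suc) (λ _ → refl) n)

B-suc : ∀ n → B (suc n) ≡ Wₒ n
B-suc n = trans
  (cong +_ (count-cong (words (suc n) (suc n)) (λ w → cong (isCatalan w ∧_) (weaklyOddUp≡weaklyUp w))))
  (count-catalan (not ∘ isEven) isEven not-isEven-suc n)

E-root : ∀ m → E (suc (suc m)) ≡ E (suc m) + E′ (suc m) + (E′ ⊛ E) m
E-root = walks-root isEven (λ d → ⟦ not (isEven d) ⟧)

E′-root : ∀ m → E′ (suc (suc m)) ≡ E′ (suc m) + E (suc m) + (E ⊛ E′) m
E′-root = walks-root (isEven ∘ suc) (λ d → ⟦ not (isEven (suc d)) ⟧)

Wₑ-root : ∀ m → Wₑ (suc (suc m)) ≡ Wₑ (suc m) + Wₒ (suc m) + (E ⊛ Wₑ) m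
Wₑ-root = walks-root (isEven ∘ suc) (λ _ → + 1)

Wₒ-root : ∀ m → Wₒ (suc (suc m)) ≡ Wₒ (suc m) + Wₑ (suc m) + (E′ ⊛ Wₒ) m
Wₒ-root = walks-root isEven (λ _ → + 1)

E′-suc : ∀ m → E′ (suc m) ≡ E (suc m)
E′-suc zero    = refl
E′-suc (suc m) = begin
  E′ (suc (suc m))
    ≡⟨ E′-root m ⟩
  E′ (suc m) + E (suc m) + (E ⊛ E′) m
    ≡⟨ cong₂ (λ x y → x + E (suc m) + y) (E′-suc m) (⊛-comm E E′ m) ⟩
  E (suc m) + E (suc m) + (E′ ⊛ E) m
    ≡⟨ cong (λ x → E (suc m) + x + (E′ ⊛ E) m) (sym (E′-suc m)) ⟩
  E (suc m) + E′ (suc m) + (E′ ⊛ E) m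
    ≡⟨ sym (E-root m) ⟩
  E (suc (suc m))
    ∎

E′≋δ⊕E : E′ ≋ δ ⊕ E
E′≋δ⊕E zero    = refl
E′≋δ⊕E (suc n) = trans (E′-suc n) (sym (ℤₚ.+-identityˡ (E (suc n))))

E′-⊛ : ∀ g n → (E′ ⊛ g) n ≡ g n + (E ⊛ g) n
E′-⊛ g n = trans (⊛-congˡ g E′≋δ⊕E n)
                 (trans (⊛-distribʳ-⊕ δ E g n) (cong (_+ (E ⊛ g) n) (δ-⊛ g n)))

-- Coefficientwise form of  E = x + x (2 + x) E + x² E².
E-quadratic : ∀ m → E (suc (suc m)) ≡ E (suc m) + E (suc m) + (E m + (E ⊛ E) m)
E-quadratic m = trans (E-root m) (cong₂ (λ x y → E (suc m) + x + y) (E′-suc m) (E′-⊛ E m))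

E-suc : ∀ m → E (suc m) ≡ δ m + (E m + E m) + shift E m + shift (E ⊛ E) m
E-suc zero    = refl
E-suc (suc m) = trans (E-quadratic m) (rearrange (E (suc m)) (E m) ((E ⊛ E) m))
  where
  rearrange : ∀ a b c → a + a + (b + c) ≡ + 0 + (a + a) + b + c
  rearrange = solve-∀

Φ Ψ : PS
Φ = δ ⊕ (E ⊕ E)
Ψ = Φ ⊕ shift E

Φ-⊛ : ∀ g n → (Φ ⊛ g) n ≡ g n + ((E ⊛ g) n + (E ⊛ g) n)
Φ-⊛ g n = trans (⊛-distribʳ-⊕ δ (E ⊕ E) g n) (cong₂ _+_ (δ-⊛ g n) (⊛-distribʳ-⊕ E E g n))

Ψ-⊛ : ∀ g n → (Ψ ⊛ g) n ≡ (Φ ⊛ g) n + shift (E ⊛ g) n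
Ψ-⊛ g n = trans (⊛-distribʳ-⊕ Φ (shift E) g n) (cong (λ s → (Φ ⊛ g) n + s) (shift-⊛ E g n))

RootRecurrence : PS → PS → Set
RootRecurrence u v = ∀ m →
  u (suc (suc m)) ≡ u (suc m) + v (suc m) + (E ⊛ u) m ×
  v (suc (suc m)) ≡ v (suc m) + u (suc m) + (E′ ⊛ v) m

rootRecurrence-unique : ∀ {u v u′ v′} → RootRecurrence u v → RootRecurrence u′ v′ →
  u 0 ≡ u′ 0 → u 1 ≡ u′ 1 → v 0 ≡ v′ 0 → v 1 ≡ v′ 1 → u ≋ u′ × v ≋ v′
rootRecurrence-unique {u} {v} {u′} {v′} rec rec′ u₀ u₁ v₀ v₁ =
  (λ n → proj₁ (agree n)) , (λ n → proj₂ (agree n))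
  where
  agree : ∀ n → u n ≡ u′ n × v n ≡ v′ n
  agree = <-rec _ λ where
    zero          _  → u₀ , v₀
    (suc zero)    _  → u₁ , v₁
    (suc (suc m)) ih →
      let u≡ , v≡ = ih (ℕₚ.n<1+n (suc m))
          earlier : ∀ j → j ≤ m → u j ≡ u′ j × v j ≡ v′ j
          earlier j j≤m = ih (s≤s (ℕₚ.m≤n⇒m≤1+n j≤m))
      in trans (proj₁ (rec m)) (trans (cong₂ _+_ (cong₂ _+_ u≡ v≡)
                  (⊛-congʳ-upTo E m (λ j j≤m → proj₁ (earlier j j≤m)))) (sym (proj₁ (rec′ m))))
       , trans (proj₂ (rec m)) (trans (cong₂ _+_ (cong₂ _+_ v≡ u≡)
                  (⊛-congʳ-upTo E′ m (λ j j≤m → proj₂ (earlier j j≤m)))) (sym (proj₂ (rec′ m))))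

Φ-Ψ-root : RootRecurrence Φ Ψ
Φ-Ψ-root m = Φ-root , Ψ-root
  where
  a = E (suc m)
  b = E m
  c = (E ⊛ E) m
  E⊛Φ : (E ⊛ Φ) m ≡ b + (c + c)
  E⊛Φ = trans (⊛-comm E Φ m) (Φ-⊛ E m)
  Φ-root : Φ (suc (suc m)) ≡ Φ (suc m) + Ψ (suc m) + (E ⊛ Φ) m
  Φ-root = begin
    + 0 + (E (suc (suc m)) + E (suc (suc m)))
      ≡⟨ cong (λ x → + 0 + (x + x)) (E-quadratic m) ⟩
    + 0 + ((a + a + (b + c)) + (a + a + (b + c)))
      ≡⟨ rearrange a b c ⟩
    (+ 0 + (a + a)) + ((+ 0 + (a + a)) + b) + (b + (c + c))
      ≡⟨ cong (λ x → (+ 0 + (a + a)) + ((+ 0 + (a + a)) + b) + x) (sym E⊛Φ) ⟩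
    Φ (suc m) + Ψ (suc m) + (E ⊛ Φ) m
      ∎
    where
    rearrange : ∀ a b c → + 0 + ((a + a + (b + c)) + (a + a + (b + c)))
                        ≡ (+ 0 + (a + a)) + ((+ 0 + (a + a)) + b) + (b + (c + c))
    rearrange = solve-∀
  Ψ-root : Ψ (suc (suc m)) ≡ Ψ (suc m) + Φ (suc m) + (E′ ⊛ Ψ) m
  Ψ-root = begin
    + 0 + (E (suc (suc m)) + E (suc (suc m))) + a
      ≡⟨ cong₂ (λ x y → + 0 + (x + x) + y) (E-quadratic m) (E-suc m) ⟩
    + 0 + ((a + a + (b + c)) + (a + a + (b + c))) + (d + (b + b) + s + t)
      ≡⟨ rearrange a b c d s t ⟩
    (+ 0 + (a + a) + b) + (+ 0 + (a + a)) + ((d + (b + b) + s) + (b + (c + c) + t))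
      ≡⟨ cong (λ x → (+ 0 + (a + a) + b) + (+ 0 + (a + a)) + x) (sym E′⊛Ψ) ⟩
    Ψ (suc m) + Φ (suc m) + (E′ ⊛ Ψ) m
      ∎
    where
    d = δ m
    s = shift E m
    t = shift (E ⊛ E) m
    E′⊛Ψ : (E′ ⊛ Ψ) m ≡ Ψ m + (b + (c + c) + t)
    E′⊛Ψ = trans (E′-⊛ Ψ m) (cong (λ x → Ψ m + x)
             (trans (⊛-comm E Ψ m) (trans (Ψ-⊛ E m) (cong (_+ t) (Φ-⊛ E m)))))
    rearrange : ∀ a b c d s t →
      + 0 + ((a + a + (b + c)) + (a + a + (b + c))) + (d + (b + b) + s + t)
      ≡ (+ 0 + (a + a) + b) + (+ 0 + (a + a)) + ((d + (b + b) + s) + (b + (c + c) + t))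
    rearrange = solve-∀

Wₑ≋Φ×Wₒ≋Ψ : Wₑ ≋ Φ × Wₒ ≋ Ψ
Wₑ≋Φ×Wₒ≋Ψ = rootRecurrence-unique (λ m → Wₑ-root m , Wₒ-root m) Φ-Ψ-root refl refl refl refl

-- S = 1 − x − x A = 1 − 2x − x² Φ.
S : PS
S zero          = + 1
S (suc zero)    = - (+ 2)
S (suc (suc n)) = - Φ n

S-⊛ : ∀ g n → (S ⊛ g) (suc (suc n)) ≡ + 1 * g (suc (suc n)) + (- (+ 2) * g (suc n) + - (Φ ⊛ g) n)
S-⊛ g n = trans (⊛-suc S g (suc n)) (cong (λ s → + 1 * g (suc (suc n)) + s)
            (trans (⊛-suc (S ∘ suc) g n) (cong (λ s → - (+ 2) * g (suc n) + s) (⊛-negˡ Φ g n))))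

E⊛S : ∀ n → (E ⊛ S) (suc (suc n)) ≡ - (E ⊛ E) n
E⊛S n = begin
  (E ⊛ S) (suc (suc n))
    ≡⟨ trans (⊛-comm E S (suc (suc n))) (S-⊛ E n) ⟩
  + 1 * E (suc (suc n)) + (- (+ 2) * a + - (Φ ⊛ E) n)
    ≡⟨ cong₂ (λ x y → + 1 * x + (- (+ 2) * a + - y)) (E-quadratic n) (Φ-⊛ E n) ⟩
  + 1 * (a + a + (b + c)) + (- (+ 2) * a + - (b + (c + c)))
    ≡⟨ simplify a b c ⟩
  - c ∎
  where
  a = E (suc n)
  b = E n
  c = (E ⊛ E) n
  simplify : ∀ a b c → + 1 * (a + a + (b + c)) + (- (+ 2) * a + - (b + (c + c))) ≡ - c
  simplify = solve-∀

S⊛S≋D : S ⊛ S ≋ D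
S⊛S≋D 0 = refl
S⊛S≋D 1 = refl
S⊛S≋D 2 = refl
S⊛S≋D 3 = refl
S⊛S≋D (suc (suc (suc (suc n)))) = begin
  (S ⊛ S) (suc (suc (suc (suc n))))
    ≡⟨ S-⊛ S (suc (suc n)) ⟩
  + 1 * - (+ 0 + (E (suc (suc n)) + E (suc (suc n))))
  + (- (+ 2) * - (+ 0 + (a + a)) + - (Φ ⊛ S) (suc (suc n)))
    ≡⟨ cong₂ (λ x y → + 1 * - (+ 0 + (x + x)) + (- (+ 2) * - (+ 0 + (a + a)) + - y))
             (E-quadratic n) Φ⊛S ⟩
  + 1 * - (+ 0 + ((a + a + (b + c)) + (a + a + (b + c))))
  + (- (+ 2) * - (+ 0 + (a + a)) + - (- (d + (b + b)) + (- c + - c)))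
    ≡⟨ simplify a b c d ⟩
  d ∎
  where
  a = E (suc n)
  b = E n
  c = (E ⊛ E) n
  d = δ n
  Φ⊛S : (Φ ⊛ S) (suc (suc n)) ≡ - (d + (b + b)) + (- c + - c)
  Φ⊛S = trans (Φ-⊛ S (suc (suc n))) (cong (λ x → S (suc (suc n)) + (x + x)) (E⊛S n))
  simplify : ∀ a b c d → + 1 * - (+ 0 + ((a + a + (b + c)) + (a + a + (b + c))))
                         + (- (+ 2) * - (+ 0 + (a + a)) + - (- (d + (b + b)) + (- c + - c))) ≡ d
  simplify = solve-∀

A-equation : poly (+ 0 ∷ + 1 ∷ []) ⊛ A ≋ poly (+ 1 ∷ - (+ 1) ∷ []) ⊕ ⊝ S
A-equation zero          = refl
A-equation (suc zero)    = refl
A-equation (suc (suc n)) = begin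
  (poly (+ 0 ∷ + 1 ∷ []) ⊛ A) (suc (suc n))  ≡⟨ linear-⊛ (+ 0) (+ 1) A (suc n) ⟩
  + 0 + + 1 * A (suc n)                      ≡⟨ cong (λ x → + 0 + + 1 * x) (A-suc n) ⟩
  + 0 + + 1 * Wₑ n                           ≡⟨ cong (λ x → + 0 + + 1 * x) (proj₁ Wₑ≋Φ×Wₒ≋Ψ n) ⟩
  + 0 + + 1 * Φ n                            ≡⟨ simplify (Φ n) ⟩
  + 0 + - - Φ n                              ∎
  where
  simplify : ∀ p → + 0 + + 1 * p ≡ + 0 + - - p
  simplify = solve-∀

B-equation : poly (+ 0 ∷ + 2 ∷ []) ⊛ B
             ≋ ⊝ poly (- (+ 2) ∷ + 1 ∷ + 2 ∷ + 1 ∷ []) ⊕ ⊝ (poly (+ 2 ∷ + 1 ∷ []) ⊛ S)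
B-equation 0 = refl
B-equation 1 = refl
B-equation 2 = refl
B-equation 3 = refl
B-equation (suc (suc (suc (suc n)))) = begin
  (poly (+ 0 ∷ + 2 ∷ []) ⊛ B) (suc (suc (suc (suc n))))
    ≡⟨ linear-⊛ (+ 0) (+ 2) B (suc (suc (suc n))) ⟩
  + 0 + + 2 * B (suc (suc (suc n)))
    ≡⟨ cong (λ x → + 0 + + 2 * x) (trans (B-suc (suc (suc n))) (proj₂ Wₑ≋Φ×Wₒ≋Ψ (suc (suc n)))) ⟩
  + 0 + + 2 * (p + a)
    ≡⟨ simplify p a ⟩
  - + 0 + - (+ 2 * - p + + 1 * - (+ 0 + (a + a)))
    ≡⟨ cong (λ x → - + 0 + - x) (sym (linear-⊛ (+ 2) (+ 1) S (suc (suc (suc n))))) ⟩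
  - + 0 + - (poly (+ 2 ∷ + 1 ∷ []) ⊛ S) (suc (suc (suc (suc n)))) ∎
  where
  p = Φ (suc (suc n))
  a = E (suc n)
  simplify : ∀ p a → + 0 + + 2 * (p + a) ≡ - + 0 + - (+ 2 * - p + + 1 * - (+ 0 + (a + a)))
  simplify = solve-∀

theorem9 : Σ PS (λ S →
    (S 0 ≡ + 1) × (S ⊛ S ≋ D)
    × (poly (+ 0 ∷ + 1 ∷ []) ⊛ A ≋ poly (+ 1 ∷ - (+ 1) ∷ []) ⊕ ⊝ S)
    × (poly (+ 0 ∷ + 2 ∷ []) ⊛ B
        ≋ ⊝ poly (- (+ 2) ∷ + 1 ∷ + 2 ∷ + 1 ∷ []) ⊕ ⊝ (poly (+ 2 ∷ + 1 ∷ []) ⊛ S)))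
theorem9 = S , refl , S⊛S≋D , A-equation , B-equation
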